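{- Let $W$ be a left $SL(2,\mathbb{Z})$-module, $W_+$ the subgroup fixed by $-I$ (a $PSL(2,\mathbb{Z})$-module), and let $M_W(PSL(2,\mathbb{Z}))$ be the group of $W$-valued pseudo-measures $\mu$ with $\mu(g\alpha,g\beta)=g[\mu(\alpha,\beta)]$ for all $g\in SL(2,\mathbb{Z})$ (these take values in $W_+$). For such $\mu$ and $\alpha\in\mathbf{P}^1(\mathbb{Q})$ put $c^\mu_\alpha(g)=\mu(g\alpha,\alpha)$ for $g\in PSL(2,\mathbb{Z})$. Then: (i) $c^\mu_\infty(\sigma)=c^\mu_\infty(\tau)=-\mu(\infty,0)\in W_+$; (ii) $\mu\mapsto c^\mu_\infty$ is a bijection from $M_W(PSL(2,\mathbb{Z}))$ onto the set $Z^1(PSL(2,\mathbb{Z}),W_+)_{cusp}$ of $1$-cocycles $c:PSL(2,\mathbb{Z})\to W_+$ (i.e. $c(gh)=c(g)+g\,c(h)$) satisfying $c(\sigma)=c(\tau)$.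
   Context: $\mathbf{P}^1(\mathbb{Q})=\mathbb{Q}\cup\{\infty\}$ with fractional linear action. A $W$-valued pseudo-measure is a function $\mu:\mathbf{P}^1(\mathbb{Q})^2\to W$ with $\mu(\alpha,\alpha)=0$, $\mu(\alpha,\beta)+\mu(\beta,\alpha)=0$, $\mu(\alpha,\beta)+\mu(\beta,\gamma)+\mu(\gamma,\alpha)=0$. $\sigma$ and $\tau$ denote the images in $PSL(2,\mathbb{Z})$ of $\begin{pmatrix}0&-1\\1&0\end{pmatrix}$ and $\begin{pmatrix}0&-1\\1&-1\end{pmatrix}$. -}

module Defs where

open import Level using (Level; _⊔_) renaming (suc to lsuc)
open import Algebra.Bundles using (AbelianGroup)
open import Data.Integer as ℤ using (ℤ; 1ℤ; 0ℤ; -1ℤ)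
open import Data.Integer.Tactic.RingSolver using (solve-∀)
open import Data.Rational as ℚ using (ℚ; 0ℚ; _÷_; ≢-nonZero)
open import Data.Rational.Properties as ℚP using ()
open import Data.Product using (_×_)
open import Relation.Nullary using (yes; no)
open import Relation.Binary.PropositionalEquality using (_≡_; refl; trans; cong₂)

record SL2 : Set where
  constructor mkSL2
  field
    a b c d : ℤ
    det : a ℤ.* d ℤ.- b ℤ.* c ≡ 1ℤ

private
  det-mul : ∀ a b c d e f g h →
    (a ℤ.* e ℤ.+ b ℤ.* g) ℤ.* (c ℤ.* f ℤ.+ d ℤ.* h) ℤ.- (a ℤ.* f ℤ.+ b ℤ.* h) ℤ.* (c ℤ.* e ℤ.+ d ℤ.* g)
      ≡ (a ℤ.* d ℤ.- b ℤ.* c) ℤ.* (e ℤ.* h ℤ.- f ℤ.* g)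
  det-mul = solve-∀

infixl 7 _·_
_·_ : SL2 → SL2 → SL2
mkSL2 a b c d p · mkSL2 e f g h q =
  mkSL2 (a ℤ.* e ℤ.+ b ℤ.* g) (a ℤ.* f ℤ.+ b ℤ.* h)
        (c ℤ.* e ℤ.+ d ℤ.* g) (c ℤ.* f ℤ.+ d ℤ.* h)
        (trans (det-mul a b c d e f g h) (cong₂ ℤ._*_ p q))

I : SL2
I = mkSL2 1ℤ 0ℤ 0ℤ 1ℤ refl

-I : SL2
-I = mkSL2 -1ℤ 0ℤ 0ℤ -1ℤ refl

neg : SL2 → SL2
neg g = -I · g

σ : SL2
σ = mkSL2 0ℤ -1ℤ 1ℤ 0ℤ refl

τ : SL2
τ = mkSL2 0ℤ -1ℤ 1ℤ -1ℤ refl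

data P1 : Set where
  ∞   : P1
  fin : ℚ → P1

-- the point [num : den] of P¹(ℚ), for (num, den) ≠ (0,0)
frac : ℚ → ℚ → P1
frac num den with den ℚP.≟ 0ℚ
... | yes _  = ∞
... | no den≢0 = fin ((num ÷ den) {{≢-nonZero den≢0}})

ι : ℤ → ℚ
ι n = n ℚ./ 1

infixr 8 _•_
_•_ : SL2 → P1 → P1
mkSL2 a b c d _ • ∞     = frac (ι a) (ι c)
mkSL2 a b c d _ • fin q = frac (ι a ℚ.* q ℚ.+ ι b) (ι c ℚ.* q ℚ.+ ι d)

record SL2Module (c ℓ : Level) : Set (lsuc (c ⊔ ℓ)) where
  field
    abGroup : AbelianGroup c ℓ
  open AbelianGroup abGroup public
  field
    act     : SL2 → Carrier → Carrier
    act-cong : ∀ g {x y} → x ≈ y → act g x ≈ act g y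
    act-hom  : ∀ g x y → act g (x ∙ y) ≈ act g x ∙ act g y
    act-id   : ∀ x → act I x ≈ x
    act-mul  : ∀ g h x → act (g · h) x ≈ act g (act h x)

module _ {c ℓ : Level} (W : SL2Module c ℓ) where
  open SL2Module W

  InW₊ : Carrier → Set ℓ
  InW₊ x = act -I x ≈ x

  record IsPseudoMeasure (μ : P1 → P1 → Carrier) : Set ℓ where
    field
      diag  : ∀ α → μ α α ≈ ε
      antisym : ∀ α β → μ α β ∙ μ β α ≈ ε
      cocycle : ∀ α β γ → (μ α β ∙ μ β γ) ∙ μ γ α ≈ ε

  record IsInvariantPseudoMeasure (μ : P1 → P1 → Carrier) : Set ℓ where
    field
      pseudo : IsPseudoMeasure μ
      equivariant : ∀ (g : SL2) α β → μ (g • α) (g • β) ≈ act g (μ α β)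

  -- c^μ_α(g) = μ(gα, α)   (depends only on the image of g in PSL(2,ℤ))
  cμ : (P1 → P1 → Carrier) → P1 → SL2 → Carrier
  cμ μ α g = μ (g • α) α

  -- Z¹(PSL(2,ℤ), W₊)_cusp : maps PSL(2,ℤ) → W₊ (represented as maps on
  -- SL(2,ℤ) invariant under g ↦ -g) satisfying the cocycle relation
  -- c(gh) = c(g) + g c(h) and c(σ) = c(τ)
  record IsCuspCocycle (f : SL2 → Carrier) : Set ℓ where
    field
      values-W₊  : ∀ g → InW₊ (f g)
      psl        : ∀ g → f (neg g) ≈ f g
      cocycle    : ∀ g h → f (g · h) ≈ f g ∙ act g (f h)
      cusp       : f σ ≈ f τ

{-# OPTIONS --safe #-}
-- Every cusp α is g • ∞ for some g ∈ SL(2,ℤ) (complete a reduced fraction to a matrix by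
-- Bézout), and g • ∞ = h • ∞ exactly when g⁻¹h is upper triangular, i.e. ±Tⁿ.  A pseudo-measure
-- is the coboundary of its potential α ↦ μ(α,∞), and for an invariant μ this potential is
-- c^μ_∞ read along g ↦ g • ∞; hence injectivity.  Conversely, τ = σT⁻¹ turns c(σ) = c(τ) into
-- σ·c(T⁻¹) = 0, so a cusp cocycle c vanishes on ±T^ℤ, factors through g ↦ g • ∞, and the
-- coboundary of that factorisation is an invariant pseudo-measure with c^μ_∞ = c.
module Submission where

open import Defs
open import Data.Empty using (⊥-elim)
open import Data.Integer as ℤ using (ℤ; +_; -[1+_]; 0ℤ; 1ℤ; -1ℤ)
import Data.Integer.Properties as ℤP
open import Data.Integer.Tactic.RingSolver using (solve-∀)
import Data.Nat as ℕ
import Data.Nat.Properties as ℕP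
open import Data.Nat.Coprimality as Coprimality using (Coprime; coprime-Bézout; recompute; 1-coprimeTo)
open import Data.Nat.GCD using (module Bézout)
open import Data.Product using (_×_; _,_; Σ; ∃-syntax; uncurry)
open import Data.Rational as ℚ using (mkℚ; 0ℚ; 1ℚ; _÷_; ≢-nonZero; NonZero; toℚᵘ; 1/_)
import Data.Rational.Properties as ℚP
open import Data.Rational.Solver using (module +-*-Solver)
import Data.Rational.Unnormalised as ℚᵘ
import Data.Rational.Unnormalised.Properties as ℚᵘP
open import Function using (_∘′_; case_of_)
open import Data.Sum using (_⊎_; inj₁; inj₂)
open import Relation.Nullary using (yes; no)
open import Relation.Nullary.Decidable using (toSum)
open import Relation.Binary.PropositionalEquality
open import Axiom.UniquenessOfIdentityProofs using (module Decidable⇒UIP)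

open +-*-Solver

-- Homogeneous coordinates on P¹(ℚ)

x÷y*y≡x : ∀ x y .{{_ : NonZero y}} → (x ÷ y) ℚ.* y ≡ x
x÷y*y≡x x y = begin
  x ℚ.* 1/ y ℚ.* y    ≡⟨ ℚP.*-assoc x (1/ y) y ⟩
  x ℚ.* (1/ y ℚ.* y)  ≡⟨ cong (x ℚ.*_) (ℚP.*-inverseˡ y) ⟩
  x ℚ.* 1ℚ            ≡⟨ ℚP.*-identityʳ x ⟩
  x                   ∎
  where open ≡-Reasoning

r*y≡x⇒x÷y≡r : ∀ {x y r} .{{_ : NonZero y}} → r ℚ.* y ≡ x → x ÷ y ≡ r
r*y≡x⇒x÷y≡r {x} {y} {r} r*y≡x = begin
  x ℚ.* 1/ y          ≡⟨ cong (ℚ._* 1/ y) r*y≡x ⟨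
  r ℚ.* y ℚ.* 1/ y    ≡⟨ ℚP.*-assoc r y (1/ y) ⟩
  r ℚ.* (y ℚ.* 1/ y)  ≡⟨ cong (r ℚ.*_) (ℚP.*-inverseʳ y) ⟩
  r ℚ.* 1ℚ            ≡⟨ ℚP.*-identityʳ r ⟩
  r                   ∎
  where open ≡-Reasoning

x*y≡0⇒x≡0 : ∀ x {y} → y ≢ 0ℚ → x ℚ.* y ≡ 0ℚ → x ≡ 0ℚ
x*y≡0⇒x≡0 x {y} y≢0 x*y≡0 = begin
  x                   ≡⟨ r*y≡x⇒x÷y≡r refl ⟨
  x ℚ.* y ℚ.* 1/ y    ≡⟨ cong (ℚ._* 1/ y) x*y≡0 ⟩
  0ℚ ℚ.* 1/ y         ≡⟨ ℚP.*-zeroˡ (1/ y) ⟩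
  0ℚ                  ∎
  where open ≡-Reasoning
        instance _ = ≢-nonZero y≢0

frac-∞ : ∀ x {y} → y ≡ 0ℚ → frac x y ≡ ∞
frac-∞ x {y} y≡0 with y ℚP.≟ 0ℚ
... | yes _   = refl
... | no y≢0  = ⊥-elim (y≢0 y≡0)

frac-fin : ∀ x {y} (y≢0 : y ≢ 0ℚ) → frac x y ≡ fin ((x ÷ y) {{≢-nonZero y≢0}})
frac-fin x {y} y≢0 with y ℚP.≟ 0ℚ
... | yes y≡0 = ⊥-elim (y≢0 y≡0)
... | no _    = refl

frac-homogeneous : ∀ x y {l} → l ≢ 0ℚ → frac (x ℚ.* l) (y ℚ.* l) ≡ frac x y
frac-homogeneous x y {l} l≢0 with y ℚP.≟ 0ℚ
... | yes y≡0 = frac-∞ _ (trans (cong (ℚ._* l) y≡0) (ℚP.*-zeroˡ l))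
... | no y≢0  = trans (frac-fin _ yl≢0) (cong fin (r*y≡x⇒x÷y≡r {{≢-nonZero yl≢0}} [x÷y]*yl≡xl))
  where
  instance _ = ≢-nonZero y≢0
  yl≢0 : y ℚ.* l ≢ 0ℚ
  yl≢0 = y≢0 ∘′ x*y≡0⇒x≡0 y l≢0
  [x÷y]*yl≡xl : (x ÷ y) ℚ.* (y ℚ.* l) ≡ x ℚ.* l
  [x÷y]*yl≡xl = trans (sym (ℚP.*-assoc (x ÷ y) y l)) (cong (ℚ._* l) (x÷y*y≡x x y))

fin-injective : ∀ {p q} → fin p ≡ fin q → p ≡ q
fin-injective refl = refl

frac≡frac⇒x*y′≡x′*y : ∀ x y x′ y′ → frac x y ≡ frac x′ y′ → x ℚ.* y′ ≡ x′ ℚ.* y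
frac≡frac⇒x*y′≡x′*y x y x′ y′ eq with y ℚP.≟ 0ℚ | y′ ℚP.≟ 0ℚ | eq
... | yes refl | yes refl | _    = trans (ℚP.*-zeroʳ x) (sym (ℚP.*-zeroʳ x′))
... | yes _    | no _     | ()
... | no _     | yes _    | ()
... | no y≢0   | no y′≢0  | fin-x÷y≡fin-x′÷y′ = begin
    x ℚ.* y′                  ≡⟨ cong (ℚ._* y′) (x÷y*y≡x x y) ⟨
    (x ÷ y) ℚ.* y ℚ.* y′      ≡⟨ cong (λ q → q ℚ.* y ℚ.* y′) (fin-injective fin-x÷y≡fin-x′÷y′) ⟩
    (x′ ÷ y′) ℚ.* y ℚ.* y′    ≡⟨ solve 3 (λ q y y′ → q :* y :* y′ := q :* y′ :* y) refl (x′ ÷ y′) y y′ ⟩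
    (x′ ÷ y′) ℚ.* y′ ℚ.* y    ≡⟨ cong (ℚ._* y) (x÷y*y≡x x′ y′) ⟩
    x′ ℚ.* y                  ∎
  where open ≡-Reasoning
        instance _ = ≢-nonZero y≢0
                 _ = ≢-nonZero y′≢0

toℚᵘ-ι : ∀ n → toℚᵘ (ι n) ≡ ℚᵘ.mkℚᵘ n 0
toℚᵘ-ι n = cong toℚᵘ (ℚP.↥p/↧p≡p (mkℚ n 0 (Coprimality.sym (1-coprimeTo ℤ.∣ n ∣))))

ι-injective : ∀ {m n} → ι m ≡ ι n → m ≡ n
ι-injective {m} {n} ιm≡ιn = cong ℚᵘ.↥_ (trans (sym (toℚᵘ-ι m)) (trans (cong toℚᵘ ιm≡ιn) (toℚᵘ-ι n)))

ι-homo-* : ∀ m n → ι (m ℤ.* n) ≡ ι m ℚ.* ι n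
ι-homo-* m n = ℚP.toℚᵘ-injective (begin
  toℚᵘ (ι (m ℤ.* n))                  ≡⟨ toℚᵘ-ι (m ℤ.* n) ⟩
  ℚᵘ.mkℚᵘ m 0 ℚᵘ.* ℚᵘ.mkℚᵘ n 0        ≡⟨ cong₂ ℚᵘ._*_ (toℚᵘ-ι m) (toℚᵘ-ι n) ⟨
  toℚᵘ (ι m) ℚᵘ.* toℚᵘ (ι n)          ≈⟨ ℚP.toℚᵘ-homo-* (ι m) (ι n) ⟨
  toℚᵘ (ι m ℚ.* ι n)                  ∎)
  where open ℚᵘP.≃-Reasoning

ι-homo-+ : ∀ m n → ι (m ℤ.+ n) ≡ ι m ℚ.+ ι n
ι-homo-+ m n = ℚP.toℚᵘ-injective (begin
  toℚᵘ (ι (m ℤ.+ n))                  ≡⟨ toℚᵘ-ι (m ℤ.+ n) ⟩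
  ℚᵘ.mkℚᵘ (m ℤ.+ n) 0                 ≈⟨ ℚᵘ.*≡* (common-denominator m n) ⟩
  ℚᵘ.mkℚᵘ m 0 ℚᵘ.+ ℚᵘ.mkℚᵘ n 0        ≡⟨ cong₂ ℚᵘ._+_ (toℚᵘ-ι m) (toℚᵘ-ι n) ⟨
  toℚᵘ (ι m) ℚᵘ.+ toℚᵘ (ι n)          ≈⟨ ℚP.toℚᵘ-homo-+ (ι m) (ι n) ⟨
  toℚᵘ (ι m ℚ.+ ι n)                  ∎)
  where
  open ℚᵘP.≃-Reasoning
  common-denominator : ∀ m n → (m ℤ.+ n) ℤ.* 1ℤ ≡ (m ℤ.* 1ℤ ℤ.+ n ℤ.* 1ℤ) ℤ.* 1ℤ
  common-denominator = solve-∀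

ι-homo-linear : ∀ a x b y → ι (a ℤ.* x ℤ.+ b ℤ.* y) ≡ ι a ℚ.* ι x ℚ.+ ι b ℚ.* ι y
ι-homo-linear a x b y = trans (ι-homo-+ (a ℤ.* x) (b ℤ.* y)) (cong₂ ℚ._+_ (ι-homo-* a x) (ι-homo-* b y))

-- The group SL(2,ℤ)

SL2-≡ : ∀ {a b c d a′ b′ c′ d′} {p : a ℤ.* d ℤ.- b ℤ.* c ≡ 1ℤ} {p′ : a′ ℤ.* d′ ℤ.- b′ ℤ.* c′ ≡ 1ℤ} →
        a ≡ a′ → b ≡ b′ → c ≡ c′ → d ≡ d′ → mkSL2 a b c d p ≡ mkSL2 a′ b′ c′ d′ p′
SL2-≡ {a} {b} {c} {d} {p = p} {p′} refl refl refl refl =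
  cong (mkSL2 a b c d) (Decidable⇒UIP.≡-irrelevant ℤ._≟_ p p′)

inv : SL2 → SL2
inv (mkSL2 a b c d det) = mkSL2 d (ℤ.- b) (ℤ.- c) a (trans (adjugate-det a b c d) det)
  where
  adjugate-det : ∀ a b c d → d ℤ.* a ℤ.- ℤ.- b ℤ.* ℤ.- c ≡ a ℤ.* d ℤ.- b ℤ.* c
  adjugate-det = solve-∀

inv-inverseˡ : ∀ g → inv g · g ≡ I
inv-inverseˡ (mkSL2 a b c d det) =
  SL2-≡ (trans (diagonal₁ a b c d) det) (off-diagonal₁ b d) (off-diagonal₂ a c) (trans (diagonal₂ a b c d) det)
  where
  diagonal₁ : ∀ a b c d → d ℤ.* a ℤ.+ ℤ.- b ℤ.* c ≡ a ℤ.* d ℤ.- b ℤ.* c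
  diagonal₁ = solve-∀
  off-diagonal₁ : ∀ b d → d ℤ.* b ℤ.+ ℤ.- b ℤ.* d ≡ 0ℤ
  off-diagonal₁ = solve-∀
  off-diagonal₂ : ∀ a c → ℤ.- c ℤ.* a ℤ.+ a ℤ.* c ≡ 0ℤ
  off-diagonal₂ = solve-∀
  diagonal₂ : ∀ a b c d → ℤ.- c ℤ.* b ℤ.+ a ℤ.* d ≡ a ℤ.* d ℤ.- b ℤ.* c
  diagonal₂ = solve-∀

·-inv-cancelˡ : ∀ g h → g · (inv g · h) ≡ h
·-inv-cancelˡ (mkSL2 a b c d det) (mkSL2 a′ b′ c′ d′ _) =
  SL2-≡ (by-det (row₁ a b c d a′ c′)) (by-det (row₁ a b c d b′ d′))
        (by-det (row₂ a b c d a′ c′)) (by-det (row₂ a b c d b′ d′))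
  where
  row₁ : ∀ a b c d x y → a ℤ.* (d ℤ.* x ℤ.+ ℤ.- b ℤ.* y) ℤ.+ b ℤ.* (ℤ.- c ℤ.* x ℤ.+ a ℤ.* y)
                           ≡ (a ℤ.* d ℤ.- b ℤ.* c) ℤ.* x
  row₁ = solve-∀
  row₂ : ∀ a b c d x y → c ℤ.* (d ℤ.* x ℤ.+ ℤ.- b ℤ.* y) ℤ.+ d ℤ.* (ℤ.- c ℤ.* x ℤ.+ a ℤ.* y)
                           ≡ (a ℤ.* d ℤ.- b ℤ.* c) ℤ.* y
  row₂ = solve-∀
  by-det : ∀ {l z} → l ≡ (a ℤ.* d ℤ.- b ℤ.* c) ℤ.* z → l ≡ z
  by-det {z = z} l≡det*z = trans l≡det*z (trans (cong (ℤ._* z) det) (ℤP.*-identityˡ z))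

T : ℤ → SL2
T n = mkSL2 1ℤ n 0ℤ 1ℤ (unipotent-det n)
  where
  unipotent-det : ∀ n → 1ℤ ℤ.* 1ℤ ℤ.- n ℤ.* 0ℤ ≡ 1ℤ
  unipotent-det = solve-∀

T-homo-+ : ∀ m n → T m · T n ≡ T (m ℤ.+ n)
T-homo-+ m n = SL2-≡ (diagonal m) (translation m n) refl refl
  where
  diagonal : ∀ m → 1ℤ ℤ.* 1ℤ ℤ.+ m ℤ.* 0ℤ ≡ 1ℤ
  diagonal = solve-∀
  translation : ∀ m n → 1ℤ ℤ.* n ℤ.+ m ℤ.* 1ℤ ≡ m ℤ.+ n
  translation = solve-∀

T0≡I : T 0ℤ ≡ I
T0≡I = SL2-≡ refl refl refl refl

inv-T : ∀ n → inv (T n) ≡ T (ℤ.- n)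
inv-T n = SL2-≡ refl refl refl refl

τ≡σ·T-1 : τ ≡ σ · T -1ℤ
τ≡σ·T-1 = SL2-≡ refl refl refl refl

m*n≡1⇒m≡n≡±1 : ∀ m n → m ℤ.* n ≡ 1ℤ → (m ≡ 1ℤ × n ≡ 1ℤ) ⊎ (m ≡ -1ℤ × n ≡ -1ℤ)
m*n≡1⇒m≡n≡±1 m n m*n≡1 = by-cases m (ℕP.m*n≡1⇒m≡1 ℤ.∣ m ∣ ℤ.∣ n ∣ ∣m∣*∣n∣≡1) m*n≡1
  where
  ∣m∣*∣n∣≡1 : ℤ.∣ m ∣ ℕ.* ℤ.∣ n ∣ ≡ 1
  ∣m∣*∣n∣≡1 = trans (sym (ℤP.abs-* m n)) (cong ℤ.∣_∣ m*n≡1)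
  n≡-1*[-1*n] : ∀ n → n ≡ -1ℤ ℤ.* (-1ℤ ℤ.* n)
  n≡-1*[-1*n] = solve-∀
  by-cases : ∀ m → ℤ.∣ m ∣ ≡ 1 → m ℤ.* n ≡ 1ℤ → (m ≡ 1ℤ × n ≡ 1ℤ) ⊎ (m ≡ -1ℤ × n ≡ -1ℤ)
  by-cases (+ 1)    _ 1*n≡1  = inj₁ (refl , trans (sym (ℤP.*-identityˡ n)) 1*n≡1)
  by-cases -[1+ 0 ] _ -n≡1   = inj₂ (refl , trans (n≡-1*[-1*n] n) (cong (-1ℤ ℤ.*_) -n≡1))
  by-cases (+ 0)              ()
  by-cases (+ ℕ.suc (ℕ.suc _)) ()
  by-cases -[1+ ℕ.suc _ ]     ()

upper-triangular : ∀ g → SL2.c g ≡ 0ℤ → ∃[ b ] (g ≡ T b ⊎ g ≡ neg (T b))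
upper-triangular (mkSL2 a b .0ℤ d det) refl with m*n≡1⇒m≡n≡±1 a d (trans (sym (ad-b0≡ad a b d)) det)
  where
  ad-b0≡ad : ∀ a b d → a ℤ.* d ℤ.- b ℤ.* 0ℤ ≡ a ℤ.* d
  ad-b0≡ad = solve-∀
... | inj₁ (refl , refl) = b , inj₁ (SL2-≡ refl refl refl refl)
... | inj₂ (refl , refl) = ℤ.- b , inj₂ (SL2-≡ refl (b≡-1*-b+0 b) refl refl)
  where
  b≡-1*-b+0 : ∀ b → b ≡ -1ℤ ℤ.* ℤ.- b ℤ.+ 0ℤ ℤ.* 1ℤ
  b≡-1*-b+0 = solve-∀

-- The action on P¹(ℚ)

•-frac : ∀ g x y → (y ≡ 0ℚ → x ≢ 0ℚ) →
         g • frac x y ≡ frac (ι (SL2.a g) ℚ.* x ℚ.+ ι (SL2.b g) ℚ.* y)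
                             (ι (SL2.c g) ℚ.* x ℚ.+ ι (SL2.d g) ℚ.* y)
•-frac g@(mkSL2 a b c d _) x y [x,y]≢0 with toSum (y ℚP.≟ 0ℚ)
... | inj₁ y≡0 = begin
  g • frac x y                  ≡⟨ cong (g •_) (frac-∞ x y≡0) ⟩
  frac (ι a) (ι c)              ≡⟨ frac-homogeneous (ι a) (ι c) ([x,y]≢0 y≡0) ⟨
  frac (ι a ℚ.* x) (ι c ℚ.* x)  ≡⟨ cong₂ frac (add-zero a b) (add-zero c d) ⟩
  frac (ι a ℚ.* x ℚ.+ ι b ℚ.* y) (ι c ℚ.* x ℚ.+ ι d ℚ.* y) ∎
  where
  open ≡-Reasoning
  add-zero : ∀ p r → ι p ℚ.* x ≡ ι p ℚ.* x ℚ.+ ι r ℚ.* y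
  add-zero p r = begin
    ι p ℚ.* x                     ≡⟨ ℚP.+-identityʳ (ι p ℚ.* x) ⟨
    ι p ℚ.* x ℚ.+ 0ℚ              ≡⟨ cong (ι p ℚ.* x ℚ.+_) (ℚP.*-zeroʳ (ι r)) ⟨
    ι p ℚ.* x ℚ.+ ι r ℚ.* 0ℚ      ≡⟨ cong (λ y → ι p ℚ.* x ℚ.+ ι r ℚ.* y) y≡0 ⟨
    ι p ℚ.* x ℚ.+ ι r ℚ.* y       ∎
... | inj₂ y≢0 = begin
  g • frac x y                  ≡⟨ cong (g •_) (frac-fin x y≢0) ⟩
  frac (ι a ℚ.* q ℚ.+ ι b) (ι c ℚ.* q ℚ.+ ι d)                     ≡⟨ frac-homogeneous _ _ y≢0 ⟨
  frac ((ι a ℚ.* q ℚ.+ ι b) ℚ.* y) ((ι c ℚ.* q ℚ.+ ι d) ℚ.* y)     ≡⟨ cong₂ frac (clear-denominator a b) (clear-denominator c d) ⟩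
  frac (ι a ℚ.* x ℚ.+ ι b ℚ.* y) (ι c ℚ.* x ℚ.+ ι d ℚ.* y) ∎
  where
  open ≡-Reasoning
  instance _ = ≢-nonZero y≢0
  q = x ÷ y
  clear-denominator : ∀ p r → (ι p ℚ.* q ℚ.+ ι r) ℚ.* y ≡ ι p ℚ.* x ℚ.+ ι r ℚ.* y
  clear-denominator p r =
    trans (solve 4 (λ P R Q Y → (P :* Q :+ R) :* Y := P :* (Q :* Y) :+ R :* Y) refl (ι p) (ι r) q y)
          (cong (λ z → ι p ℚ.* z ℚ.+ ι r ℚ.* y) (x÷y*y≡x x y))

first-column-≢0 : ∀ g → SL2.c g ≡ 0ℤ → SL2.a g ≢ 0ℤ
first-column-≢0 (mkSL2 .0ℤ b .0ℤ d det) refl refl = 0≢1 (trans (sym (zero-det b d)) det)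
  where
  zero-det : ∀ b d → 0ℤ ℤ.* d ℤ.- b ℤ.* 0ℤ ≡ 0ℤ
  zero-det = solve-∀
  0≢1 : 0ℤ ≢ 1ℤ
  0≢1 ()

•-·-∞ : ∀ g h → (g · h) • ∞ ≡ g • (h • ∞)
•-·-∞ g@(mkSL2 a b c d _) h@(mkSL2 e _ k _ _) = begin
  frac (ι (a ℤ.* e ℤ.+ b ℤ.* k)) (ι (c ℤ.* e ℤ.+ d ℤ.* k))
    ≡⟨ cong₂ frac (ι-homo-linear a e b k) (ι-homo-linear c e d k) ⟩
  frac (ι a ℚ.* ι e ℚ.+ ι b ℚ.* ι k) (ι c ℚ.* ι e ℚ.+ ι d ℚ.* ι k)
    ≡⟨ •-frac g (ι e) (ι k) (λ ιk≡0 ιe≡0 → first-column-≢0 h (ι-injective ιk≡0) (ι-injective ιe≡0)) ⟨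
  g • frac (ι e) (ι k) ∎
  where open ≡-Reasoning

neg-•-∞ : ∀ g → neg g • ∞ ≡ g • ∞
neg-•-∞ (mkSL2 a b c d _) = begin
  frac (ι (-1ℤ ℤ.* a ℤ.+ 0ℤ ℤ.* c)) (ι (0ℤ ℤ.* a ℤ.+ -1ℤ ℤ.* c))
    ≡⟨ cong₂ frac (cong ι (upper a c)) (cong ι (lower a c)) ⟩
  frac (ι (a ℤ.* -1ℤ)) (ι (c ℤ.* -1ℤ))
    ≡⟨ cong₂ frac (ι-homo-* a -1ℤ) (ι-homo-* c -1ℤ) ⟩
  frac (ι a ℚ.* ι -1ℤ) (ι c ℚ.* ι -1ℤ)
    ≡⟨ frac-homogeneous (ι a) (ι c) (λ ()) ⟩
  frac (ι a) (ι c) ∎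
  where
  open ≡-Reasoning
  upper : ∀ a c → -1ℤ ℤ.* a ℤ.+ 0ℤ ℤ.* c ≡ a ℤ.* -1ℤ
  upper = solve-∀
  lower : ∀ a c → 0ℤ ℤ.* a ℤ.+ -1ℤ ℤ.* c ≡ c ℤ.* -1ℤ
  lower = solve-∀

-I-•-∞ : ∀ g → -I • (g • ∞) ≡ g • ∞
-I-•-∞ g = trans (sym (•-·-∞ -I g)) (neg-•-∞ g)

-- Every cusp is in the orbit of ∞

1+a*b≡c*d⇒ℤ : ∀ a b c d → 1 ℕ.+ a ℕ.* b ≡ c ℕ.* d → 1ℤ ℤ.+ + a ℤ.* + b ≡ + c ℤ.* + d
1+a*b≡c*d⇒ℤ a b c d eq = begin
  1ℤ ℤ.+ + a ℤ.* + b    ≡⟨ cong (ℤ._+_ 1ℤ) (ℤP.pos-* a b) ⟨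
  1ℤ ℤ.+ + (a ℕ.* b)    ≡⟨ cong +_ eq ⟩
  + (c ℕ.* d)           ≡⟨ ℤP.pos-* c d ⟩
  + c ℤ.* + d           ∎
  where open ≡-Reasoning

1+z-z≡1 : ∀ z → 1ℤ ℤ.+ z ℤ.- z ≡ 1ℤ
1+z-z≡1 = solve-∀

ℕ-bézout : ∀ m D → Bézout.Identity 1 m D → ∃[ X ] ∃[ Y ] + m ℤ.* X ℤ.- Y ℤ.* + D ≡ 1ℤ
ℕ-bézout m D (Bézout.+- x y 1+yD≡xm) = + x , + y , det
  where
  open ≡-Reasoning
  det : + m ℤ.* + x ℤ.- + y ℤ.* + D ≡ 1ℤ
  det = begin
    + m ℤ.* + x ℤ.- + y ℤ.* + D              ≡⟨ cong (ℤ._- (+ y ℤ.* + D)) (ℤP.*-comm (+ m) (+ x)) ⟩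
    + x ℤ.* + m ℤ.- + y ℤ.* + D              ≡⟨ cong (ℤ._- (+ y ℤ.* + D)) (1+a*b≡c*d⇒ℤ y D x m 1+yD≡xm) ⟨
    1ℤ ℤ.+ + y ℤ.* + D ℤ.- + y ℤ.* + D       ≡⟨ 1+z-z≡1 (+ y ℤ.* + D) ⟩
    1ℤ                                       ∎
ℕ-bézout m D (Bézout.-+ x y 1+xm≡yD) = ℤ.- + x , ℤ.- + y , det
  where
  open ≡-Reasoning
  swap-signs : ∀ m x y D → m ℤ.* ℤ.- x ℤ.- ℤ.- y ℤ.* D ≡ y ℤ.* D ℤ.- x ℤ.* m
  swap-signs = solve-∀
  det : + m ℤ.* ℤ.- + x ℤ.- ℤ.- + y ℤ.* + D ≡ 1ℤ
  det = begin
    + m ℤ.* ℤ.- + x ℤ.- ℤ.- + y ℤ.* + D      ≡⟨ swap-signs (+ m) (+ x) (+ y) (+ D) ⟩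
    + y ℤ.* + D ℤ.- + x ℤ.* + m              ≡⟨ cong (ℤ._- (+ x ℤ.* + m)) (1+a*b≡c*d⇒ℤ x m y D 1+xm≡yD) ⟨
    1ℤ ℤ.+ + x ℤ.* + m ℤ.- + x ℤ.* + m       ≡⟨ 1+z-z≡1 (+ x ℤ.* + m) ⟩
    1ℤ                                       ∎

bézout : ∀ n D → Coprime ℤ.∣ n ∣ D → ∃[ X ] ∃[ Y ] n ℤ.* X ℤ.- Y ℤ.* + D ≡ 1ℤ
bézout (+ m)    D coprime = ℕ-bézout m D (coprime-Bézout coprime)
bézout -[1+ m ] D coprime with ℕ-bézout (ℕ.suc m) D (coprime-Bézout coprime)
... | X , Y , det = ℤ.- X , Y , trans (cong (ℤ._- (Y ℤ.* + D)) (neg*neg (+ ℕ.suc m) X)) det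
  where
  neg*neg : ∀ p x → ℤ.- p ℤ.* ℤ.- x ≡ p ℤ.* x
  neg*neg = solve-∀

rep : P1 → SL2
rep ∞ = I
rep (fin (mkℚ n d-1 coprime)) with bézout n (ℕ.suc d-1) (recompute coprime)
... | X , Y , det = mkSL2 n Y (+ ℕ.suc d-1) X det

rep-•∞ : ∀ α → rep α • ∞ ≡ α
rep-•∞ ∞ = refl
rep-•∞ (fin q@(mkℚ n d-1 coprime)) with bézout n (ℕ.suc d-1) (recompute coprime)
... | _ = trans (frac-fin (ι n) ιD≢0) (cong fin (r*y≡x⇒x÷y≡r {{≢-nonZero ιD≢0}} q*ιD≡ιn))
  where
  ιD≢0 : ι (+ ℕ.suc d-1) ≢ 0ℚ
  ιD≢0 ιD≡0 = case ι-injective {+ ℕ.suc d-1} {0ℤ} ιD≡0 of λ ()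
  q*ιD≡ιn : q ℚ.* ι (+ ℕ.suc d-1) ≡ ι n
  q*ιD≡ιn = ℚP.toℚᵘ-injective (begin
    toℚᵘ (q ℚ.* ι (+ ℕ.suc d-1))                    ≈⟨ ℚP.toℚᵘ-homo-* q (ι (+ ℕ.suc d-1)) ⟩
    ℚᵘ.mkℚᵘ n d-1 ℚᵘ.* toℚᵘ (ι (+ ℕ.suc d-1))        ≡⟨ cong (ℚᵘ.mkℚᵘ n d-1 ℚᵘ.*_) (toℚᵘ-ι (+ ℕ.suc d-1)) ⟩
    ℚᵘ.mkℚᵘ n d-1 ℚᵘ.* ℚᵘ.mkℚᵘ (+ ℕ.suc d-1) 0      ≈⟨ ℚᵘ.*≡* (cancel-denominator n d-1) ⟩
    ℚᵘ.mkℚᵘ n 0                                      ≡⟨ toℚᵘ-ι n ⟨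
    toℚᵘ (ι n)                                       ∎)
    where
    open ℚᵘP.≃-Reasoning
    cancel-denominator : ∀ n d-1 → (n ℤ.* + ℕ.suc d-1) ℤ.* 1ℤ ≡ n ℤ.* + ℕ.suc (d-1 ℕ.* 1)
    cancel-denominator n d-1 = trans (ℤP.*-identityʳ _) (cong (λ k → n ℤ.* + ℕ.suc k) (sym (ℕP.*-identityʳ d-1)))

-I-• : ∀ α → -I • α ≡ α
-I-• α = begin
  -I • α              ≡⟨ cong (-I •_) (rep-•∞ α) ⟨
  -I • (rep α • ∞)    ≡⟨ -I-•-∞ (rep α) ⟩
  rep α • ∞           ≡⟨ rep-•∞ α ⟩
  α                   ∎
  where open ≡-Reasoning

•∞≡•∞⇒upper-triangular : ∀ g h → g • ∞ ≡ h • ∞ → SL2.c (inv g · h) ≡ 0ℤ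
•∞≡•∞⇒upper-triangular (mkSL2 a _ c _ _) (mkSL2 a′ _ c′ _ _) g∞≡h∞ = begin
  ℤ.- c ℤ.* a′ ℤ.+ a ℤ.* c′   ≡⟨ cong (ℤ._+_ (ℤ.- c ℤ.* a′)) a*c′≡a′*c ⟩
  ℤ.- c ℤ.* a′ ℤ.+ a′ ℤ.* c   ≡⟨ cancel c a′ ⟩
  0ℤ                          ∎
  where
  open ≡-Reasoning
  a*c′≡a′*c : a ℤ.* c′ ≡ a′ ℤ.* c
  a*c′≡a′*c = ι-injective (begin
    ι (a ℤ.* c′)      ≡⟨ ι-homo-* a c′ ⟩
    ι a ℚ.* ι c′      ≡⟨ frac≡frac⇒x*y′≡x′*y (ι a) (ι c) (ι a′) (ι c′) g∞≡h∞ ⟩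
    ι a′ ℚ.* ι c      ≡⟨ ι-homo-* a′ c ⟨
    ι (a′ ℤ.* c)      ∎)
  cancel : ∀ c a′ → ℤ.- c ℤ.* a′ ℤ.+ a′ ℤ.* c ≡ 0ℤ
  cancel = solve-∀

-- Pseudo-measures and cocycles

module _ {c ℓ} (W : SL2Module c ℓ) where
  open SL2Module W
    renaming (refl to ≈-refl; sym to ≈-sym; trans to ≈-trans; reflexive to ≈-reflexive; setoid to W-setoid)
  open import Algebra.Properties.AbelianGroup abGroup
  open import Relation.Binary.Reasoning.Setoid W-setoid

  act-ε : ∀ g → act g ε ≈ ε
  act-ε g = identityʳ-unique (act g ε) (act g ε) (begin
    act g ε ∙ act g ε  ≈⟨ act-hom g ε ε ⟨
    act g (ε ∙ ε)      ≈⟨ act-cong g (identityʳ ε) ⟩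
    act g ε            ∎)

  act-homo-⁻¹ : ∀ g x → act g (x ⁻¹) ≈ act g x ⁻¹
  act-homo-⁻¹ g x = inverseʳ-unique (act g x) (act g (x ⁻¹)) (begin
    act g x ∙ act g (x ⁻¹)  ≈⟨ act-hom g x (x ⁻¹) ⟨
    act g (x ∙ x ⁻¹)        ≈⟨ act-cong g (inverseʳ x) ⟩
    act g ε                 ≈⟨ act-ε g ⟩
    ε                       ∎)

  act-homo‿- : ∀ g x y → act g (x - y) ≈ act g x - act g y
  act-homo‿- g x y = ≈-trans (act-hom g x (y ⁻¹)) (∙-congˡ (act-homo-⁻¹ g y))

  act-reflects-ε : ∀ g x → act g x ≈ ε → x ≈ ε
  act-reflects-ε g x gx≈ε = begin
    x                      ≈⟨ act-id x ⟨
    act I x                ≡⟨ cong (λ h → act h x) (inv-inverseˡ g) ⟨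
    act (inv g · g) x      ≈⟨ act-mul (inv g) g x ⟩
    act (inv g) (act g x)  ≈⟨ act-cong (inv g) gx≈ε ⟩
    act (inv g) ε          ≈⟨ act-ε (inv g) ⟩
    ε                      ∎

  [x-y]∙[y-z]≈x-z : ∀ x y z → (x - y) ∙ (y - z) ≈ x - z
  [x-y]∙[y-z]≈x-z x y z = ≈-trans (≈-sym (assoc (x - y) y (z ⁻¹))) (∙-congʳ (//-rightDividesˡ y x))

  [x∙y]-[x∙z]≈y-z : ∀ x y z → (x ∙ y) - (x ∙ z) ≈ y - z
  [x∙y]-[x∙z]≈y-z x y z = begin
    (x ∙ y) ∙ (x ∙ z) ⁻¹         ≈⟨ ∙-congˡ (⁻¹-∙-comm x z) ⟨
    (x ∙ y) ∙ (x ⁻¹ ∙ z ⁻¹)      ≈⟨ assoc (x ∙ y) (x ⁻¹) (z ⁻¹) ⟨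
    (x ∙ y) ∙ x ⁻¹ ∙ z ⁻¹        ≈⟨ ∙-congʳ (xyx⁻¹≈y x y) ⟩
    y - z                       ∎

  coboundary : (P1 → Carrier) → P1 → P1 → Carrier
  coboundary φ α β = φ α - φ β

  coboundary-isPseudoMeasure : ∀ φ → IsPseudoMeasure W (coboundary φ)
  coboundary-isPseudoMeasure φ = record
    { diag    = λ α → inverseʳ (φ α)
    ; antisym = λ α β → ≈-trans ([x-y]∙[y-z]≈x-z (φ α) (φ β) (φ α)) (inverseʳ (φ α))
    ; cocycle = λ α β γ → ≈-trans (∙-congʳ ([x-y]∙[y-z]≈x-z (φ α) (φ β) (φ γ)))
                                  (≈-trans ([x-y]∙[y-z]≈x-z (φ α) (φ γ) (φ α)) (inverseʳ (φ α)))
    }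

  coboundary-equivariant : ∀ φ (f : SL2 → Carrier) → (∀ g α → φ (g • α) ≈ f g ∙ act g (φ α)) →
                           ∀ g α β → coboundary φ (g • α) (g • β) ≈ act g (coboundary φ α β)
  coboundary-equivariant φ f φ-twisted g α β = begin
    φ (g • α) - φ (g • β)                           ≈⟨ //-cong₂ (φ-twisted g α) (φ-twisted g β) ⟩
    (f g ∙ act g (φ α)) - (f g ∙ act g (φ β))       ≈⟨ [x∙y]-[x∙z]≈y-z (f g) (act g (φ α)) (act g (φ β)) ⟩
    act g (φ α) - act g (φ β)                       ≈⟨ act-homo‿- g (φ α) (φ β) ⟨
    act g (φ α - φ β)                               ∎

  module PseudoMeasure {μ : P1 → P1 → Carrier} (pm : IsPseudoMeasure W μ) where
    open IsPseudoMeasure pm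

    μ-flip : ∀ α β → μ β α ≈ μ α β ⁻¹
    μ-flip α β = inverseʳ-unique (μ α β) (μ β α) (antisym α β)

    μ-chain : ∀ α β γ → μ α γ ≈ μ α β ∙ μ β γ
    μ-chain α β γ = ≈-trans (μ-flip γ α) (≈-sym (inverseˡ-unique _ _ (cocycle α β γ)))

    μ≈coboundary : ∀ γ α β → μ α β ≈ coboundary (λ α → μ α γ) α β
    μ≈coboundary γ α β = ≈-trans (μ-chain α γ β) (∙-congˡ (μ-flip β γ))

  IsCocycle : (SL2 → Carrier) → Set ℓ
  IsCocycle f = ∀ g h → f (g · h) ≈ f g ∙ act g (f h)

  module Cocycle (f : SL2 → Carrier) (cocycle : IsCocycle f) where

    f-I≈ε : f I ≈ ε
    f-I≈ε = identityʳ-unique (f I) (f I) (begin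
      f I ∙ f I            ≈⟨ ∙-congˡ (act-id (f I)) ⟨
      f I ∙ act I (f I)    ≈⟨ cocycle I I ⟨
      f (I · I)            ≡⟨ cong f (SL2-≡ refl refl refl refl) ⟩
      f I                  ∎)

    f-·-ε : ∀ g h → f g ≈ ε → f h ≈ ε → f (g · h) ≈ ε
    f-·-ε g h fg≈ε fh≈ε = begin
      f (g · h)            ≈⟨ cocycle g h ⟩
      f g ∙ act g (f h)    ≈⟨ ∙-cong fg≈ε (≈-trans (act-cong g fh≈ε) (act-ε g)) ⟩
      ε ∙ ε                ≈⟨ identityˡ ε ⟩
      ε                    ∎

    f-inv-ε : ∀ g → f g ≈ ε → f (inv g) ≈ ε
    f-inv-ε g fg≈ε = begin
      f (inv g)                    ≈⟨ identityʳ (f (inv g)) ⟨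
      f (inv g) ∙ ε                ≈⟨ ∙-congˡ (≈-trans (act-cong (inv g) fg≈ε) (act-ε (inv g))) ⟨
      f (inv g) ∙ act (inv g) (f g) ≈⟨ cocycle (inv g) g ⟨
      f (inv g · g)                ≡⟨ cong f (inv-inverseˡ g) ⟩
      f I                          ≈⟨ f-I≈ε ⟩
      ε                            ∎

    f-T-ε : f (T 1ℤ) ≈ ε → ∀ n → f (T n) ≈ ε
    f-T-ε fT≈ε (+ 0)              = ≈-trans (≈-reflexive (cong f T0≡I)) f-I≈ε
    f-T-ε fT≈ε (+ ℕ.suc n)        = ≈-trans (≈-reflexive (cong f (sym (T-homo-+ 1ℤ (+ n)))))
                                             (f-·-ε (T 1ℤ) (T (+ n)) fT≈ε (f-T-ε fT≈ε (+ n)))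
    f-T-ε fT≈ε -[1+ 0 ]           = ≈-trans (≈-reflexive (cong f (sym (inv-T 1ℤ))))
                                             (f-inv-ε (T 1ℤ) fT≈ε)
    f-T-ε fT≈ε -[1+ ℕ.suc n ]     = ≈-trans (≈-reflexive (cong f (sym (T-homo-+ -1ℤ -[1+ n ]))))
                                             (f-·-ε (T -1ℤ) (T -[1+ n ]) (f-T-ε fT≈ε -1ℤ) (f-T-ε fT≈ε -[1+ n ]))

    module _ (f-neg : ∀ g → f (neg g) ≈ f g) (fT≈ε : f (T 1ℤ) ≈ ε) where

      f-±T-ε : ∀ g b → g ≡ T b ⊎ g ≡ neg (T b) → f g ≈ ε
      f-±T-ε g b (inj₁ g≡T)  = ≈-trans (≈-reflexive (cong f g≡T)) (f-T-ε fT≈ε b)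
      f-±T-ε g b (inj₂ g≡-T) = ≈-trans (≈-reflexive (cong f g≡-T)) (≈-trans (f-neg (T b)) (f-T-ε fT≈ε b))

      f-upper-triangular-ε : ∀ g → SL2.c g ≡ 0ℤ → f g ≈ ε
      f-upper-triangular-ε g c≡0 = uncurry (f-±T-ε g) (upper-triangular g c≡0)

      f-•∞ : ∀ g h → g • ∞ ≡ h • ∞ → f h ≈ f g
      f-•∞ g h g∞≡h∞ = begin
        f h                              ≡⟨ cong f (·-inv-cancelˡ g h) ⟨
        f (g · (inv g · h))              ≈⟨ cocycle g (inv g · h) ⟩
        f g ∙ act g (f (inv g · h))      ≈⟨ ∙-congˡ (act-cong g (f-upper-triangular-ε (inv g · h) (•∞≡•∞⇒upper-triangular g h g∞≡h∞))) ⟩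
        f g ∙ act g ε                    ≈⟨ ∙-congˡ (act-ε g) ⟩
        f g ∙ ε                          ≈⟨ identityʳ (f g) ⟩
        f g                              ∎

  cuspCocycle-T≈ε : ∀ {f} → IsCuspCocycle W f → f (T 1ℤ) ≈ ε
  cuspCocycle-T≈ε {f} cc = ≈-trans (≈-reflexive (cong f (sym (inv-T -1ℤ)))) (f-inv-ε (T -1ℤ) fT⁻¹≈ε)
    where
    open IsCuspCocycle cc
    open Cocycle f cocycle
    fT⁻¹≈ε : f (T -1ℤ) ≈ ε
    fT⁻¹≈ε = act-reflects-ε σ (f (T -1ℤ)) (identityʳ-unique (f σ) _ (begin
      f σ ∙ act σ (f (T -1ℤ))   ≈⟨ cocycle σ (T -1ℤ) ⟨
      f (σ · T -1ℤ)             ≡⟨ cong f τ≡σ·T-1 ⟨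
      f τ                       ≈⟨ cusp ⟨
      f σ                       ∎))

  InW₊-resp : ∀ {x y} → x ≈ y → InW₊ W x → InW₊ W y
  InW₊-resp x≈y -Ix≈x = ≈-trans (act-cong -I (≈-sym x≈y)) (≈-trans -Ix≈x x≈y)

  invariantPseudoMeasure-W₊ : ∀ {μ} → IsInvariantPseudoMeasure W μ → ∀ α β → InW₊ W (μ α β)
  invariantPseudoMeasure-W₊ {μ} ipm α β = begin
    act -I (μ α β)          ≈⟨ equivariant -I α β ⟨
    μ (-I • α) (-I • β)     ≡⟨ cong₂ μ (-I-• α) (-I-• β) ⟩
    μ α β                   ∎
    where open IsInvariantPseudoMeasure ipm

  cμ-∞-at-generators : ∀ μ → IsInvariantPseudoMeasure W μ →
                       (cμ W μ ∞ σ ≈ μ ∞ (fin 0ℚ) ⁻¹) × (cμ W μ ∞ τ ≈ μ ∞ (fin 0ℚ) ⁻¹) × InW₊ W (μ ∞ (fin 0ℚ) ⁻¹)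
  -- σ • ∞ and τ • ∞ both evaluate to fin 0ℚ.
  cμ-∞-at-generators μ ipm = μ-flip ∞ (fin 0ℚ) , μ-flip ∞ (fin 0ℚ) ,
                             InW₊-resp (μ-flip ∞ (fin 0ℚ)) (invariantPseudoMeasure-W₊ ipm (fin 0ℚ) ∞)
    where
    open IsInvariantPseudoMeasure ipm
    open PseudoMeasure pseudo

  cμ-isCuspCocycle : ∀ {μ} → IsInvariantPseudoMeasure W μ → IsCuspCocycle W (cμ W μ ∞)
  cμ-isCuspCocycle {μ} ipm = record
    { values-W₊ = λ g → invariantPseudoMeasure-W₊ ipm (g • ∞) ∞
    ; psl       = λ g → ≈-reflexive (cong (λ α → μ α ∞) (neg-•-∞ g))
    ; cocycle   = λ g h → begin
        μ ((g · h) • ∞) ∞                        ≡⟨ cong (λ α → μ α ∞) (•-·-∞ g h) ⟩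
        μ (g • (h • ∞)) ∞                        ≈⟨ μ-chain (g • (h • ∞)) (g • ∞) ∞ ⟩
        μ (g • (h • ∞)) (g • ∞) ∙ μ (g • ∞) ∞    ≈⟨ ∙-congʳ (equivariant g (h • ∞) ∞) ⟩
        act g (μ (h • ∞) ∞) ∙ μ (g • ∞) ∞        ≈⟨ comm _ _ ⟩
        μ (g • ∞) ∞ ∙ act g (μ (h • ∞) ∞)        ∎
    ; cusp      = ≈-refl
    }
    where
    open IsInvariantPseudoMeasure ipm
    open PseudoMeasure pseudo

  cμ-injective : ∀ μ ν → IsInvariantPseudoMeasure W μ → IsInvariantPseudoMeasure W ν →
                 (∀ g → cμ W μ ∞ g ≈ cμ W ν ∞ g) → ∀ α β → μ α β ≈ ν α β
  cμ-injective μ ν ipm ipν cμ≈cν α β = begin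
    μ α β                     ≈⟨ PseudoMeasure.μ≈coboundary (IsInvariantPseudoMeasure.pseudo ipm) ∞ α β ⟩
    μ α ∞ - μ β ∞             ≈⟨ //-cong₂ (μ∞≈ν∞ α) (μ∞≈ν∞ β) ⟩
    ν α ∞ - ν β ∞             ≈⟨ PseudoMeasure.μ≈coboundary (IsInvariantPseudoMeasure.pseudo ipν) ∞ α β ⟨
    ν α β                     ∎
    where
    μ∞≈ν∞ : ∀ α → μ α ∞ ≈ ν α ∞
    μ∞≈ν∞ α = begin
      μ α ∞               ≡⟨ cong (λ α → μ α ∞) (rep-•∞ α) ⟨
      μ (rep α • ∞) ∞     ≈⟨ cμ≈cν (rep α) ⟩
      ν (rep α • ∞) ∞     ≡⟨ cong (λ α → ν α ∞) (rep-•∞ α) ⟩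
      ν α ∞               ∎

  cμ-surjective : ∀ f → IsCuspCocycle W f →
                  Σ (P1 → P1 → Carrier) (λ μ → IsInvariantPseudoMeasure W μ × (∀ g → cμ W μ ∞ g ≈ f g))
  cμ-surjective f cc = coboundary φ , isInvariant , cμ≈f
    where
    open IsCuspCocycle cc
    open Cocycle f cocycle
    φ : P1 → Carrier
    φ α = f (rep α)
    φ-twisted : ∀ g α → φ (g • α) ≈ f g ∙ act g (φ α)
    φ-twisted g α = ≈-trans (f-•∞ psl (cuspCocycle-T≈ε cc) (g · rep α) (rep (g • α)) g·rep-α∞≡rep-gα∞)
                            (cocycle g (rep α))
      where
      g·rep-α∞≡rep-gα∞ : (g · rep α) • ∞ ≡ rep (g • α) • ∞
      g·rep-α∞≡rep-gα∞ = trans (•-·-∞ g (rep α)) (trans (cong (g •_) (rep-•∞ α)) (sym (rep-•∞ (g • α))))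
    isInvariant : IsInvariantPseudoMeasure W (coboundary φ)
    isInvariant = record
      { pseudo      = coboundary-isPseudoMeasure φ
      ; equivariant = coboundary-equivariant φ f φ-twisted
      }
    cμ≈f : ∀ g → cμ W (coboundary φ) ∞ g ≈ f g
    cμ≈f g = begin
      f (rep (g • ∞)) - f I     ≈⟨ //-cong₂ (f-•∞ psl (cuspCocycle-T≈ε cc) g (rep (g • ∞)) (sym (rep-•∞ (g • ∞)))) f-I≈ε ⟩
      f g - ε                   ≈⟨ ∙-congˡ ε⁻¹≈ε ⟩
      f g ∙ ε                   ≈⟨ identityʳ (f g) ⟩
      f g                       ∎

proposition2p4p3 : ∀ {c ℓ} (W : SL2Module c ℓ) →
  let open SL2Module W in
  -- (i)
  (∀ μ → IsInvariantPseudoMeasure W μ →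
    (cμ W μ ∞ σ ≈ (μ ∞ (fin 0ℚ)) ⁻¹)
    × (cμ W μ ∞ τ ≈ (μ ∞ (fin 0ℚ)) ⁻¹)
    × InW₊ W ((μ ∞ (fin 0ℚ)) ⁻¹))
  -- (ii) μ ↦ c^μ_∞ maps M_W(PSL(2,ℤ)) into Z¹(PSL(2,ℤ),W₊)_cusp ...
  × (∀ μ → IsInvariantPseudoMeasure W μ → IsCuspCocycle W (cμ W μ ∞))
  -- ... injectively ...
  × (∀ μ ν → IsInvariantPseudoMeasure W μ → IsInvariantPseudoMeasure W ν →
      (∀ g → cμ W μ ∞ g ≈ cμ W ν ∞ g) → ∀ α β → μ α β ≈ ν α β)
  -- ... and surjectively
  × (∀ f → IsCuspCocycle W f →
      Σ (P1 → P1 → Carrier) (λ μ →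
        IsInvariantPseudoMeasure W μ × (∀ g → cμ W μ ∞ g ≈ f g)))
proposition2p4p3 W = cμ-∞-at-generators W , (λ _ → cμ-isCuspCocycle W) , cμ-injective W , cμ-surjective W
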